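{- Let $n\ge 1$ and $0\le k\le n-1$ be integers. The number of partitions $\pi$ into distinct parts with $\mathrm{rank}(\pi)=k$ and $\Gamma(\pi)=n$ equals the number of partitions $\lambda$ into odd parts with $\ell(\lambda)=k+1$ and $\Gamma(\lambda)=n$. When $k\equiv n-1\pmod 2$, both numbers equal $\binom{(n+k-1)/2}{k}$.
   Context: For a non-empty partition $\pi=(\pi_1\ge\cdots\ge\pi_r\ge1)$, $\ell(\pi)=r$, $\Gamma(\pi)=\pi_1+\ell(\pi)-1$ (length of the largest hook) and $\mathrm{rank}(\pi)=\pi_1-\ell(\pi)$. -}

module Defs where

open import Data.Nat using (ℕ; zero; suc; _+_; _∸_; _≤_; _<_; _≥_; _>_; _%_)
open import Data.List using (List; []; _∷_; length)
open import Data.List.Relation.Unary.All using (All)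
open import Data.List.Relation.Unary.Linked using (Linked)
open import Data.Integer using (ℤ; +_; _-_)
open import Data.Product using (Σ; _×_)
open import Relation.Binary.PropositionalEquality using (_≡_)

IsPartition : List ℕ → Set
IsPartition π = All (λ x → 0 < x) π × Linked _≥_ π

HasDistinctParts : List ℕ → Set
HasDistinctParts π = Linked _>_ π

HasOddParts : List ℕ → Set
HasOddParts π = All (λ x → x % 2 ≡ 1) π

ℓ : List ℕ → ℕ
ℓ π = length π

largest : List ℕ → ℕ
largest [] = 0
largest (x ∷ _) = x

-- Γ(π) = π₁ + ℓ(π) − 1 (only meaningful for non-empty π; Γ [] = 0)
Γ : List ℕ → ℕ
Γ [] = 0
Γ (x ∷ xs) = x + length xs

rank : List ℕ → ℤ
rank π = (+ largest π) - (+ ℓ π)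

DistinctRankΓ : ℕ → ℕ → Set
DistinctRankΓ k n =
  Σ (List ℕ) λ π → IsPartition π × HasDistinctParts π × rank π ≡ + k × Γ π ≡ n

OddLengthΓ : ℕ → ℕ → Set
OddLengthΓ k n =
  Σ (List ℕ) λ λ' → IsPartition λ' × HasOddParts λ' × ℓ λ' ≡ suc k × Γ λ' ≡ n

-- Write n = k + 1 + 2j. A partition into distinct parts with rank k and Γ = n has exactly
-- j + 1 parts and largest part j + k + 1, so it is that part followed by a j-element subset
-- of {1, …, j + k}. A partition into k + 1 odd parts with Γ = n has largest part 2j + 1,
-- followed by a multiset of k odd numbers at most 2j + 1. Splitting on whether the next part
-- is as large as possible gives Pascal's rule for both families, so both have C(j + k, k)
-- elements. If n − 1 − k is odd, both families are empty: for distinct parts n − 1 − k is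
-- twice the number of parts after the first, for odd parts it is twice ⌊π₁ / 2⌋.
module Submission where

open import Defs
open import Data.Nat using (ℕ; _+_; _∸_; _≤_; _%_; _/_)
open import Data.Nat.Combinatorics using (_C_)
open import Data.Fin using (Fin)
open import Data.Product using (_×_; ∃-syntax)
open import Function.Bundles using (_↔_)
open import Relation.Binary.PropositionalEquality using (_≡_)

open import Axiom.UniquenessOfIdentityProofs using (module Decidable⇒UIP)
open import Data.Fin as Fin using ()
open import Data.Fin.Properties using (+↔⊎)
open import Data.Integer using (+_; _⊖_)
import Data.Integer.Properties as ℤ
open import Data.List using (List; []; _∷_; length)
open import Data.List.Relation.Unary.All as All using (All; []; _∷_)
open import Data.List.Relation.Unary.Linked as Linked using (Linked; [-]; _∷_)
open import Data.Nat using (zero; suc; _*_; _<_; _>_; _≥_; z≤n; s≤s; z<s; _≟_)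
open import Data.Nat.Combinatorics using (nCk+nC[k+1]≡[n+1]C[k+1]; nCn≡1; nCk≡nC[n∸k])
open import Data.Nat.DivMod using (m≡m%n+[m/n]*n; [m+kn]%n≡m%n; m*n/n≡m)
open import Data.Nat.Properties
open import Data.Nat.Tactic.RingSolver using (solve-∀)
open import Data.Product using (Σ; _,_; proj₁; proj₂)
open import Data.Sum using (_⊎_; inj₁; inj₂)
open import Data.Sum.Function.Propositional using (_⊎-↔_)
open import Function using (_∘_)
open import Function.Bundles using (mk↔ₛ′)
open import Function.Properties.Inverse using (↔-sym)
open import Function.Related.Propositional using (module EquationalReasoning)
open import Relation.Binary.PropositionalEquality
  using (refl; sym; trans; cong; cong₂; subst; _≢_; module ≡-Reasoning)
open import Relation.Nullary using (¬_; yes; no; contradiction)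
open import Relation.Nullary.Irrelevant using (Irrelevant)

×-irrelevant : ∀ {A B : Set} → Irrelevant A → Irrelevant B → Irrelevant (A × B)
×-irrelevant A-irr B-irr (a , b) (a′ , b′) = cong₂ _,_ (A-irr a a′) (B-irr b b′)

subtype-≡ : ∀ {A : Set} {P : A → Set} → (∀ {x} → Irrelevant (P x)) →
            {u v : Σ A P} → proj₁ u ≡ proj₁ v → u ≡ v
subtype-≡ P-irr {x , p} {.x , q} refl = cong (x ,_) (P-irr p q)

empty↔Fin0 : ∀ {A : Set} → ¬ A → A ↔ Fin 0
empty↔Fin0 ¬a = mk↔ₛ′ (λ a → contradiction a ¬a) (λ ()) (λ ()) λ a → contradiction a ¬a

fixed-head-↔ : ∀ {P Q : List ℕ → Set} {h} →
               (∀ {xs} → Irrelevant (P xs)) → (∀ {xs} → Irrelevant (Q xs)) →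
               ¬ P [] → (∀ {x xs} → P (x ∷ xs) → x ≡ h × Q xs) →
               (∀ {xs} → Q xs → P (h ∷ xs)) →
               Σ (List ℕ) P ↔ Σ (List ℕ) Q
fixed-head-↔ {P} {Q} {h} P-irr Q-irr ¬P[] uncons cons =
  mk↔ₛ′ to from (λ _ → subtype-≡ Q-irr refl) from∘to
  where
  to : Σ (List ℕ) P → Σ (List ℕ) Q
  to ([] , p) = contradiction p ¬P[]
  to (x ∷ xs , p) = xs , proj₂ (uncons p)

  from : Σ (List ℕ) Q → Σ (List ℕ) P
  from (xs , q) = h ∷ xs , cons q

  from∘to : ∀ π → from (to π) ≡ π
  from∘to ([] , p) = contradiction p ¬P[]
  from∘to (x ∷ xs , p) = subtype-≡ P-irr (cong (_∷ xs) (sym (proj₁ (uncons p))))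

Chain : (ℕ → Set) → (ℕ → ℕ → Set) → ℕ → ℕ → Set
Chain P R t k = Σ (List ℕ) λ xs → All P xs × Linked R (t ∷ xs) × length xs ≡ k

module _ {P : ℕ → Set} {R : ℕ → ℕ → Set}
         (P-irr : ∀ {x} → Irrelevant (P x)) (R-irr : ∀ {x y} → Irrelevant (R x y)) where

  Chain-irrelevant : ∀ {t k xs} → Irrelevant (All P xs × Linked R (t ∷ xs) × length xs ≡ k)
  Chain-irrelevant =
    ×-irrelevant (All.irrelevant P-irr) (×-irrelevant (Linked.irrelevant R-irr) ≡-irrelevant)

  Chain-0↔Fin1 : ∀ {t} → Chain P R t 0 ↔ Fin 1
  Chain-0↔Fin1 = mk↔ₛ′ (λ _ → Fin.zero) (λ _ → [] , [] , [-] , refl)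
                       (λ { Fin.zero → refl ; (Fin.suc ()) }) from∘to
    where
    from∘to : ∀ {t} (c : Chain P R t 0) → ([] , [] , [-] , refl) ≡ c
    from∘to ([] , _) = subtype-≡ Chain-irrelevant refl

  Chain-empty : ∀ {t k} → (∀ {y} → P y → ¬ R t y) → ¬ Chain P R t (suc k)
  Chain-empty ¬R (y ∷ _ , p ∷ _ , r ∷ _ , _) = ¬R p r

  -- h is the largest value that may follow t, and t′ caps everything below h.
  Chain-split : ∀ {t h t′ k} → P h → R t h →
                (∀ {y} → P y → R t y → y ≢ h → R t′ y) →
                (∀ {y} → R t′ y → R t y) → (∀ {y} → R t′ y → y ≢ h) →
                Chain P R t (suc k) ↔ (Chain P R h k ⊎ Chain P R t′ (suc k))
  Chain-split {t} {h} {t′} {k} Ph Rth lower widen fresh = mk↔ₛ′ to from to∘from from∘to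
    where
    to : Chain P R t (suc k) → Chain P R h k ⊎ Chain P R t′ (suc k)
    to (y ∷ ys , p ∷ ps , r ∷ rs , len) with y ≟ h
    ... | yes refl = inj₁ (ys , ps , rs , suc-injective len)
    ... | no y≢h = inj₂ (y ∷ ys , p ∷ ps , lower p r y≢h ∷ rs , len)

    from : Chain P R h k ⊎ Chain P R t′ (suc k) → Chain P R t (suc k)
    from (inj₁ (ys , ps , rs , len)) = h ∷ ys , Ph ∷ ps , Rth ∷ rs , cong suc len
    from (inj₂ (y ∷ ys , ps , r ∷ rs , len)) = y ∷ ys , ps , widen r ∷ rs , len

    to∘from : ∀ c → to (from c) ≡ c
    to∘from (inj₁ (ys , ps , rs , len)) with h ≟ h
    ... | yes refl = cong inj₁ (subtype-≡ Chain-irrelevant refl)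
    ... | no h≢h = contradiction refl h≢h
    to∘from (inj₂ (y ∷ ys , p ∷ ps , r ∷ rs , len)) with y ≟ h
    ... | yes y≡h = contradiction y≡h (fresh r)
    ... | no _ = cong inj₂ (subtype-≡ Chain-irrelevant refl)

    from∘to : ∀ c → from (to c) ≡ c
    from∘to (y ∷ ys , p ∷ ps , r ∷ rs , len) with y ≟ h
    ... | yes refl = subtype-≡ Chain-irrelevant refl
    ... | no _ = subtype-≡ Chain-irrelevant refl

-- b-element subsets of {1, …, a}, listed in decreasing order
StrictChain : ℕ → ℕ → Set
StrictChain a b = Chain (0 <_) _>_ (suc a) b

StrictChain↔Fin : ∀ a b → StrictChain a b ↔ Fin (a C b)
StrictChain↔Fin a zero = Chain-0↔Fin1 ≤-irrelevant ≤-irrelevant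
StrictChain↔Fin zero (suc b) =
  empty↔Fin0 (Chain-empty ≤-irrelevant ≤-irrelevant λ { 0<y (s≤s y≤0) → <⇒≱ 0<y y≤0 })
StrictChain↔Fin (suc a) (suc b) = begin
  StrictChain (suc a) (suc b)
    ↔⟨ Chain-split ≤-irrelevant ≤-irrelevant z<s ≤-refl
         (λ _ y<2+a y≢1+a → ≤∧≢⇒< (≤-pred y<2+a) y≢1+a) m<n⇒m<1+n <⇒≢ ⟩
  (StrictChain a b ⊎ StrictChain a (suc b))
    ↔⟨ StrictChain↔Fin a b ⊎-↔ StrictChain↔Fin a (suc b) ⟩
  (Fin (a C b) ⊎ Fin (a C suc b))
    ↔⟨ ↔-sym +↔⊎ ⟩
  Fin (a C b + a C suc b)
    ≡⟨ cong Fin (nCk+nC[k+1]≡[n+1]C[k+1] a b) ⟩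
  Fin (suc a C suc b) ∎
  where open EquationalReasoning

multiset-pascal : ∀ c k → (suc c + k) C k + (c + suc k) C suc k ≡ (suc c + suc k) C suc k
multiset-pascal c k = begin
  suc (c + k) C k + (c + suc k) C suc k
    ≡⟨ cong (λ m → suc (c + k) C k + m C suc k) (+-suc c k) ⟩
  suc (c + k) C k + suc (c + k) C suc k
    ≡⟨ nCk+nC[k+1]≡[n+1]C[k+1] (suc (c + k)) k ⟩
  suc (suc (c + k)) C suc k
    ≡⟨ cong (λ m → suc m C suc k) (+-suc c k) ⟨
  suc (c + suc k) C suc k ∎
  where open ≡-Reasoning

Odd : ℕ → Set
Odd x = x % 2 ≡ 1

odd-view : ∀ {x} → Odd x → x ≡ suc (x / 2 * 2)
odd-view {x} odd = trans (m≡m%n+[m/n]*n x 2) (cong (_+ x / 2 * 2) odd)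

1+m*2-odd : ∀ m → Odd (suc (m * 2))
1+m*2-odd m = [m+kn]%n≡m%n 1 m 2

odd⇒pos : ∀ {x} → Odd x → 0 < x
odd⇒pos {suc _} _ = z<s

odd-below : ∀ {c y} → Odd y → y ≤ suc (suc c * 2) → y ≢ suc (suc c * 2) → y ≤ suc (c * 2)
odd-below {c} {y} odd y≤ y≢ =
  subst (_≤ suc (c * 2)) (sym y≡) (s≤s (*-monoˡ-≤ 2 half≤c))
  where
  y≡ : y ≡ suc (y / 2 * 2)
  y≡ = odd-view odd
  half≤1+c : y / 2 ≤ suc c
  half≤1+c = *-cancelʳ-≤ (y / 2) (suc c) 2 (≤-pred (subst (_≤ _) y≡ y≤))
  half≤c : y / 2 ≤ c
  half≤c = ≤-pred (≤∧≢⇒< half≤1+c λ half≡ →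
             y≢ (trans y≡ (cong (λ m → suc (m * 2)) half≡)))

-- multisets of k odd numbers at most 2c + 1, listed in decreasing order
OddChain : ℕ → ℕ → Set
OddChain c k = Chain Odd _≥_ (suc (c * 2)) k

OddChain↔Fin : ∀ c k → OddChain c k ↔ Fin ((c + k) C k)
OddChain↔Fin c zero = Chain-0↔Fin1 ≡-irrelevant ≤-irrelevant
OddChain↔Fin zero (suc k) = begin
  OddChain zero (suc k)
    ↔⟨ Chain-split ≡-irrelevant ≤-irrelevant refl ≤-refl
         (λ _ y≤1 y≢1 → ≤-pred (≤∧≢⇒< y≤1 y≢1)) m≤n⇒m≤1+n (λ { z≤n () }) ⟩
  (OddChain zero k ⊎ Chain Odd _≥_ 0 (suc k))
    ↔⟨ OddChain↔Fin zero k ⊎-↔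
       empty↔Fin0 (Chain-empty ≡-irrelevant ≤-irrelevant λ { () z≤n }) ⟩
  (Fin (k C k) ⊎ Fin 0)
    ↔⟨ ↔-sym +↔⊎ ⟩
  Fin (k C k + 0)
    ≡⟨ cong Fin (trans (+-identityʳ _) (trans (nCn≡1 k) (sym (nCn≡1 (suc k))))) ⟩
  Fin (suc k C suc k) ∎
  where open EquationalReasoning
OddChain↔Fin (suc c) (suc k) = begin
  OddChain (suc c) (suc k)
    ↔⟨ Chain-split ≡-irrelevant ≤-irrelevant (1+m*2-odd (suc c)) ≤-refl (odd-below {c})
         (m≤n⇒m≤1+n ∘ m≤n⇒m≤1+n) (λ y≤ → <⇒≢ (s≤s (m≤n⇒m≤1+n y≤))) ⟩
  (OddChain (suc c) k ⊎ OddChain c (suc k))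
    ↔⟨ OddChain↔Fin (suc c) k ⊎-↔ OddChain↔Fin c (suc k) ⟩
  (Fin ((suc c + k) C k) ⊎ Fin ((c + suc k) C suc k))
    ↔⟨ ↔-sym +↔⊎ ⟩
  Fin ((suc c + k) C k + (c + suc k) C suc k)
    ≡⟨ cong Fin (multiset-pascal c k) ⟩
  Fin ((suc c + suc k) C suc k) ∎
  where open EquationalReasoning

m⊖n≡+k⇒m≡n+k : ∀ m n {k} → m ⊖ n ≡ + k → m ≡ n + k
m⊖n≡+k⇒m≡n+k m zero eq = ℤ.+-injective eq
m⊖n≡+k⇒m≡n+k zero (suc n) ()
m⊖n≡+k⇒m≡n+k (suc m) (suc n) eq =
  cong suc (m⊖n≡+k⇒m≡n+k m n (trans (sym (ℤ.[1+m]⊖[1+n]≡m⊖n m n)) eq))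

[n+k]⊖n≡+k : ∀ n k → (n + k) ⊖ n ≡ + k
[n+k]⊖n≡+k n k = trans (cong ((n + k) ⊖_) (sym (+-identityʳ n))) (ℤ.+-cancelˡ-⊖ n k 0)

rank≡⇒head≡ : ∀ {k} x xs → rank (x ∷ xs) ≡ + k → x ≡ suc (length xs + k)
rank≡⇒head≡ x xs = m⊖n≡+k⇒m≡n+k x (suc (length xs))

head≡⇒rank≡ : ∀ {k x} xs → x ≡ suc (length xs + k) → rank (x ∷ xs) ≡ + k
head≡⇒rank≡ {k} xs refl = [n+k]⊖n≡+k (suc (length xs)) k

Γ-of-rank : ∀ {k} x xs → rank (x ∷ xs) ≡ + k → Γ (x ∷ xs) ≡ suc (k + length xs * 2)
Γ-of-rank {k} x xs r =
  trans (cong (_+ length xs) (rank≡⇒head≡ x xs r)) (cong suc (arith (length xs) k))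
  where
  arith : ∀ l k → l + k + l ≡ k + l * 2
  arith = solve-∀

Γ-of-odd-head : ∀ x xs → Odd x → Γ (x ∷ xs) ≡ suc (length xs + x / 2 * 2)
Γ-of-odd-head x xs odd =
  trans (cong (_+ length xs) (odd-view odd)) (cong suc (+-comm (x / 2 * 2) (length xs)))

IsPartition-irrelevant : ∀ {π} → Irrelevant (IsPartition π)
IsPartition-irrelevant =
  ×-irrelevant (All.irrelevant ≤-irrelevant) (Linked.irrelevant ≤-irrelevant)

IsDistinctRankΓ : ℕ → ℕ → List ℕ → Set
IsDistinctRankΓ k n π = IsPartition π × HasDistinctParts π × rank π ≡ + k × Γ π ≡ n

IsDistinctRankΓ-irrelevant : ∀ {k n π} → Irrelevant (IsDistinctRankΓ k n π)
IsDistinctRankΓ-irrelevant =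
  ×-irrelevant IsPartition-irrelevant
    (×-irrelevant (Linked.irrelevant ≤-irrelevant)
      (×-irrelevant (Decidable⇒UIP.≡-irrelevant ℤ._≟_) ≡-irrelevant))

DistinctRankΓ↔StrictChain : ∀ k j → DistinctRankΓ k (suc (k + j * 2)) ↔ StrictChain (j + k) j
DistinctRankΓ↔StrictChain k j =
  fixed-head-↔ IsDistinctRankΓ-irrelevant (Chain-irrelevant ≤-irrelevant ≤-irrelevant)
    (λ ()) uncons cons
  where
  uncons : ∀ {x xs} → IsDistinctRankΓ k (suc (k + j * 2)) (x ∷ xs) →
           x ≡ suc (j + k) × All (0 <_) xs × Linked _>_ (suc (j + k) ∷ xs) × length xs ≡ j
  uncons {x} {xs} ((_ ∷ pos , _) , distinct , r , g) =
    x≡ , pos , subst (λ y → Linked _>_ (y ∷ xs)) x≡ distinct , len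
    where
    len : length xs ≡ j
    len = *-cancelʳ-≡ _ _ 2
            (+-cancelˡ-≡ k _ _ (suc-injective (trans (sym (Γ-of-rank x xs r)) g)))
    x≡ : x ≡ suc (j + k)
    x≡ = trans (rank≡⇒head≡ x xs r) (cong (λ l → suc (l + k)) len)

  cons : ∀ {xs} → All (0 <_) xs × Linked _>_ (suc (j + k) ∷ xs) × length xs ≡ j →
         IsDistinctRankΓ k (suc (k + j * 2)) (suc (j + k) ∷ xs)
  cons {xs} (pos , distinct , len) =
    (z<s ∷ pos , Linked.map <⇒≤ distinct) , distinct , r ,
    trans (Γ-of-rank _ xs r) (cong (λ l → suc (k + l * 2)) len)
    where
    r = head≡⇒rank≡ xs (cong (λ l → suc (l + k)) (sym len))

IsOddLengthΓ : ℕ → ℕ → List ℕ → Set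
IsOddLengthΓ k n π = IsPartition π × HasOddParts π × ℓ π ≡ suc k × Γ π ≡ n

IsOddLengthΓ-irrelevant : ∀ {k n π} → Irrelevant (IsOddLengthΓ k n π)
IsOddLengthΓ-irrelevant =
  ×-irrelevant IsPartition-irrelevant
    (×-irrelevant (All.irrelevant ≡-irrelevant) (×-irrelevant ≡-irrelevant ≡-irrelevant))

OddLengthΓ↔OddChain : ∀ k j → OddLengthΓ k (suc (k + j * 2)) ↔ OddChain j k
OddLengthΓ↔OddChain k j =
  fixed-head-↔ IsOddLengthΓ-irrelevant (Chain-irrelevant ≡-irrelevant ≤-irrelevant)
    (λ ()) uncons cons
  where
  uncons : ∀ {x xs} → IsOddLengthΓ k (suc (k + j * 2)) (x ∷ xs) →
           x ≡ suc (j * 2) × All Odd xs × Linked _≥_ (suc (j * 2) ∷ xs) × length xs ≡ k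
  uncons {x} {xs} ((_ , weak) , _ ∷ odds , len , g) =
    x≡ , odds , subst (λ y → Linked _≥_ (y ∷ xs)) x≡ weak , suc-injective len
    where
    x≡ : x ≡ suc (j * 2)
    x≡ = +-cancelʳ-≡ k x (suc (j * 2))
      (trans (cong (λ l → x + l) (sym (suc-injective len)))
             (trans g (cong suc (+-comm k (j * 2)))))

  cons : ∀ {xs} → All Odd xs × Linked _≥_ (suc (j * 2) ∷ xs) × length xs ≡ k →
         IsOddLengthΓ k (suc (k + j * 2)) (suc (j * 2) ∷ xs)
  cons (odds , weak , len) =
    (z<s ∷ All.map odd⇒pos odds , weak) , 1+m*2-odd j ∷ odds , cong suc len ,
    cong suc (trans (cong (λ l → j * 2 + l) len) (+-comm (j * 2) k))

GapEven : ℕ → ℕ → Set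
GapEven k n = ∃[ j ] n ≡ suc (k + j * 2)

DistinctRankΓ⇒GapEven : ∀ {k n} → DistinctRankΓ k (suc n) → GapEven k (suc n)
DistinctRankΓ⇒GapEven (x ∷ xs , _ , _ , r , g) = length xs , trans (sym g) (Γ-of-rank x xs r)

OddLengthΓ⇒GapEven : ∀ {k n} → OddLengthΓ k n → GapEven k n
OddLengthΓ⇒GapEven (x ∷ xs , _ , odd ∷ _ , len , g) =
  x / 2 , trans (sym g) (trans (Γ-of-odd-head x xs odd)
                          (cong (λ l → suc (l + x / 2 * 2)) (suc-injective len)))

GapEven⇒%2≡ : ∀ {k n} → GapEven k (suc n) → k % 2 ≡ n % 2
GapEven⇒%2≡ {k} (j , refl) = sym ([m+kn]%n≡m%n k j 2)

1≡[1+n]%2⇒n%2≡0 : ∀ n → 1 ≡ suc n % 2 → n % 2 ≡ 0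
1≡[1+n]%2⇒n%2≡0 zero _ = refl
1≡[1+n]%2⇒n%2≡0 (suc (suc n)) eq = 1≡[1+n]%2⇒n%2≡0 n eq

m%2≡[m+n]%2⇒n%2≡0 : ∀ m n → m % 2 ≡ (m + n) % 2 → n % 2 ≡ 0
m%2≡[m+n]%2⇒n%2≡0 zero n eq = sym eq
m%2≡[m+n]%2⇒n%2≡0 (suc zero) n eq = 1≡[1+n]%2⇒n%2≡0 n eq
m%2≡[m+n]%2⇒n%2≡0 (suc (suc m)) n eq = m%2≡[m+n]%2⇒n%2≡0 m n eq

%2≡⇒GapEven : ∀ {k n} → k ≤ n → k % 2 ≡ n % 2 → GapEven k (suc n)
%2≡⇒GapEven {k} {n} k≤n eq = d / 2 , cong suc (trans (sym k+d≡n) (cong (λ e → k + e) d≡))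
  where
  d = n ∸ k
  k+d≡n : k + d ≡ n
  k+d≡n = m+[n∸m]≡n k≤n
  d≡ : d ≡ d / 2 * 2
  d≡ = trans (m≡m%n+[m/n]*n d 2)
         (cong (_+ d / 2 * 2) (m%2≡[m+n]%2⇒n%2≡0 k d (trans eq (cong (_% 2) (sym k+d≡n)))))

BothCount : ℕ → ℕ → ℕ → Set
BothCount k n c = (DistinctRankΓ k n ↔ Fin c) × (OddLengthΓ k n ↔ Fin c)

GapEven⇒BothCount : ∀ {k n} → GapEven k n → BothCount k n (((n + k ∸ 1) / 2) C k)
GapEven⇒BothCount {k} (j , refl) = subst (BothCount k _) (sym count≡) (distinct , odd)
  where
  open EquationalReasoning
  arith : ∀ k j → k + j * 2 + k ≡ (j + k) * 2
  arith = solve-∀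
  count≡ : ((suc (k + j * 2) + k ∸ 1) / 2) C k ≡ (j + k) C k
  count≡ = cong (_C k) (trans (cong (_/ 2) (arith k j)) (m*n/n≡m (j + k) 2))
  distinct : DistinctRankΓ k (suc (k + j * 2)) ↔ Fin ((j + k) C k)
  distinct = begin
    DistinctRankΓ k (suc (k + j * 2))  ↔⟨ DistinctRankΓ↔StrictChain k j ⟩
    StrictChain (j + k) j              ↔⟨ StrictChain↔Fin (j + k) j ⟩
    Fin ((j + k) C j)                  ≡⟨ cong Fin (nCk≡nC[n∸k] (m≤m+n j k)) ⟩
    Fin ((j + k) C (j + k ∸ j))        ≡⟨ cong (λ i → Fin ((j + k) C i)) (m+n∸m≡n j k) ⟩
    Fin ((j + k) C k)                  ∎
  odd : OddLengthΓ k (suc (k + j * 2)) ↔ Fin ((j + k) C k)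
  odd = begin
    OddLengthΓ k (suc (k + j * 2))  ↔⟨ OddLengthΓ↔OddChain k j ⟩
    OddChain j k                    ↔⟨ OddChain↔Fin j k ⟩
    Fin ((j + k) C k)               ∎

theorem2p11 : (n k : ℕ) → 1 ≤ n → k ≤ n ∸ 1 →
    (∃[ c ] ((DistinctRankΓ k n ↔ Fin c) × (OddLengthΓ k n ↔ Fin c)))
    × (k % 2 ≡ (n ∸ 1) % 2 →
        (DistinctRankΓ k n ↔ Fin (((n + k ∸ 1) / 2) C k))
        × (OddLengthΓ k n ↔ Fin (((n + k ∸ 1) / 2) C k)))
theorem2p11 (suc n) k _ k≤n = count , GapEven⇒BothCount ∘ %2≡⇒GapEven k≤n
  where
  count : ∃[ c ] BothCount k (suc n) c
  count with k % 2 ≟ n % 2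
  ... | yes same = _ , GapEven⇒BothCount (%2≡⇒GapEven k≤n same)
  ... | no differ =
    0 , empty↔Fin0 (differ ∘ GapEven⇒%2≡ ∘ DistinctRankΓ⇒GapEven)
      , empty↔Fin0 (differ ∘ GapEven⇒%2≡ ∘ OddLengthΓ⇒GapEven)
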